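{- Let $G$ be a convex bipartite graph satisfying Property B. If $G$ is non-monotone, then $1\le |R|+|Q|\le 2$, where $Q=\{X_{p..q} : X_{p..q}\text{ is maximal},\ 1<p<q<n\}$ and $R=\{u\in Y : u \text{ is pendant and there is no } X_{p..q}\in Q \text{ with } u\in N_G(x_i) \text{ for some } p\le i\le q\}$.
   Context: All graphs are finite, simple, connected and unweighted. A convex bipartite graph is a bipartite graph $G$ with bipartition $(X,Y)$ together with an ordering $X=(x_1,\ldots,x_n)$ such that for every $y\in Y$ the neighborhood $N_G(y)$ consists of consecutive vertices of this ordering; $n=|X|$. For $1\le p<q\le n$ let $X_{p..q}=\{x_p,\ldots,x_q\}$, $N_G[X_{p..q}]=\{y\in Y : N_G(y)\subseteq X_{p..q}\}$ and $N'_G[X_{p..q}]=\{y\in Y : |N_G(y)\cap X_{p..q}|\ge 2\}$. A vertex is pendant if it has degree $1$. $G$ satisfies Property B if: (1) for all $1\le p<q\le n$ with $(p,q)\ne(1,n)$, $|N_G[X_{p..q}]|\le q-p+1$, and $|N_G[X_{1..n}]|\le n+1$; (2) for every integer $j\in\{1,\ldots,n-1\}$ and all indices with $1\le p_1<q_1\le p_2<q_2\le\cdots\le p_j<q_j\le n$, $\left|\bigcup_{i=1}^j N'_G[X_{p_i..q_i}]\right|\ge\sum_{i=1}^j (q_i-p_i)$; (3) $G$ has at most $2$ pendant vertices, and if $n\ge 2$ no $x\in X$ is adjacent to two pendant vertices of $Y$. A set $X_{p..q}$ ($1\le p<q\le n$) is maximal if $|N_G[X_{p..q}]|=q-p+1$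 and there is no $X_{p'..q'}$ with $|N_G[X_{p'..q'}]|=q'-p'+1$ and either $1<p'<p<q\le q'<n$ or $1<p'\le p<q<q'<n$. A graph $G$ satisfying Property B is non-monotone if there is a pendant vertex $y\in Y$ adjacent to some $x_k$ with $1<k<n$, or there is a maximal set $X_{p..q}$ with $1<p<q<n$. -}

module Defs where

open import Data.Nat using (ℕ; zero; suc; _+_; _∸_; _≤_; _<_; _≤ᵇ_; _<ᵇ_; _≡ᵇ_)
open import Data.Fin using (Fin; toℕ)
open import Data.Bool using (Bool; true; false; T; _∧_; _∨_; not; if_then_else_)
open import Data.List using (List; []; _∷_; [_]; length; map; allFin)
open import Data.Nat.ListAction using (sum)
open import Data.Bool.ListAction using (all; any)
open import Data.Product using (Σ; _×_; _,_; proj₁; proj₂)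
open import Data.Sum using (_⊎_; inj₁; inj₂)
open import Relation.Nullary using (¬_)
open import Relation.Binary.PropositionalEquality using (_≡_)
open import Relation.Binary.Construct.Closure.ReflexiveTransitive using (Star)

-- Convention: X = {x_1,...,x_n} is represented by Fin n, where the vertex
-- x_i (1-based, as in the paper) is the element of Fin n with toℕ = i - 1.
-- Y is represented by Fin m.  adj x y = true iff xy is an edge.
-- A bipartite graph with these vertex classes is automatically finite,
-- simple and unweighted.

countB : {k : ℕ} → (Fin k → Bool) → ℕ
countB {k} f = sum (map (λ i → if f i then 1 else 0) (allFin k))

record ConvexBipartite : Set where
  field
    n   : ℕ
    m   : ℕ
    adj : Fin n → Fin m → Bool
    convex : ∀ (y : Fin m) (i j k : Fin n) → toℕ i ≤ toℕ j → toℕ j ≤ toℕ k →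
             T (adj i y) → T (adj k y) → T (adj j y)

module _ (G : ConvexBipartite) where
  open ConvexBipartite G

  Vertex : Set
  Vertex = Fin n ⊎ Fin m

  Edge : Vertex → Vertex → Set
  Edge (inj₁ x) (inj₁ x′) = Data.Empty.⊥
    where import Data.Empty
  Edge (inj₁ x) (inj₂ y) = T (adj x y)
  Edge (inj₂ y) (inj₁ x) = T (adj x y)
  Edge (inj₂ y) (inj₂ y′) = Data.Empty.⊥
    where import Data.Empty

  Connected : Set
  Connected = ∀ (u v : Vertex) → Star Edge u v

  degX : Fin n → ℕ
  degX x = countB (adj x)

  degY : Fin m → ℕ
  degY y = countB (λ x → adj x y)

  pendantX : Fin n → Bool
  pendantX x = degX x ≡ᵇ 1

  pendantY : Fin m → Bool
  pendantY y = degY y ≡ᵇ 1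

  inRange : Fin n → Fin n → Fin n → Bool
  inRange p q x = (toℕ p ≤ᵇ toℕ x) ∧ (toℕ x ≤ᵇ toℕ q)

  inN : Fin n → Fin n → Fin m → Bool
  inN p q y = all (λ x → not (adj x y) ∨ inRange p q x) (allFin n)

  sizeN : Fin n → Fin n → ℕ
  sizeN p q = countB (inN p q)

  inN′ : Fin n → Fin n → Fin m → Bool
  inN′ p q y = 2 ≤ᵇ countB (λ x → adj x y ∧ inRange p q x)

  tight : Fin n → Fin n → Bool
  tight p q = sizeN p q ≡ᵇ (toℕ q ∸ toℕ p + 1)

  data Chain : List (Fin n × Fin n) → Set where
    chain-[] : Chain []
    chain-[_] : ∀ {p q} → toℕ p < toℕ q → Chain [ (p , q) ]
    chain-∷ : ∀ {p q p′ q′ rest} → toℕ p < toℕ q → toℕ q ≤ toℕ p′ →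
              Chain ((p′ , q′) ∷ rest) → Chain ((p , q) ∷ (p′ , q′) ∷ rest)

  sumLen : List (Fin n × Fin n) → ℕ
  sumLen [] = 0
  sumLen ((p , q) ∷ I) = (toℕ q ∸ toℕ p) + sumLen I

  sizeUnionN′ : List (Fin n × Fin n) → ℕ
  sizeUnionN′ I = countB (λ y → any (λ pq → inN′ (proj₁ pq) (proj₂ pq) y) I)

  record PropertyB : Set where
    field
      B1 : ∀ (p q : Fin n) → toℕ p < toℕ q →
           ¬ (toℕ p ≡ 0 × suc (toℕ q) ≡ n) → sizeN p q ≤ toℕ q ∸ toℕ p + 1
      B1-full : ∀ (p q : Fin n) → toℕ p < toℕ q →
           toℕ p ≡ 0 → suc (toℕ q) ≡ n → sizeN p q ≤ n + 1
      B2 : ∀ (I : List (Fin n × Fin n)) → 1 ≤ length I → length I ≤ n ∸ 1 →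
           Chain I → sumLen I ≤ sizeUnionN′ I
      B3-count : countB pendantX + countB pendantY ≤ 2
      B3-adj : 2 ≤ n → ∀ (x : Fin n) →
           countB (λ y → adj x y ∧ pendantY y) ≤ 1

  -- X_{p..q} is maximal (0-based: 1 < p' ↔ 0 < toℕ p', q' < n ↔ suc (toℕ q') < n)
  maximal : Fin n → Fin n → Bool
  maximal p q =
    (toℕ p <ᵇ toℕ q) ∧ tight p q ∧
    not (any (λ p′ → any (λ q′ →
           (toℕ p′ <ᵇ toℕ q′) ∧ tight p′ q′ ∧
           ( ((0 <ᵇ toℕ p′) ∧ (toℕ p′ <ᵇ toℕ p) ∧ (toℕ q ≤ᵇ toℕ q′) ∧ (suc (toℕ q′) <ᵇ n))
           ∨ ((0 <ᵇ toℕ p′) ∧ (toℕ p′ ≤ᵇ toℕ p) ∧ (toℕ q <ᵇ toℕ q′) ∧ (suc (toℕ q′) <ᵇ n))))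
         (allFin n)) (allFin n))

  inQ : Fin n → Fin n → Bool
  inQ p q = maximal p q ∧ (0 <ᵇ toℕ p) ∧ (toℕ p <ᵇ toℕ q) ∧ (suc (toℕ q) <ᵇ n)

  sizeQ : ℕ
  sizeQ = sum (map (λ p → countB (inQ p)) (allFin n))

  inR : Fin m → Bool
  inR u = pendantY u ∧
          not (any (λ p → any (λ q → inQ p q ∧
                 any (λ x → inRange p q x ∧ adj x u) (allFin n))
               (allFin n)) (allFin n))

  sizeR : ℕ
  sizeR = countB inR

  NonMonotone : Set
  NonMonotone =
    (Σ (Fin m) λ y → Σ (Fin n) λ x →
       T (pendantY y) × T (adj x y) × 0 < toℕ x × suc (toℕ x) < n)
    ⊎ (Σ (Fin n) λ p → Σ (Fin n) λ q →
       T (maximal p q) × 0 < toℕ p × toℕ p < toℕ q × suc (toℕ q) < n)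

module Submission where

-- Lower bound: a witness of non-monotonicity is a member of Q, or a pendant vertex,
-- which is then adjacent to a member of Q or lies in R.
-- Upper bound, by counting Y: distinct members of Q are separated by at least one vertex,
-- since otherwise supermodularity of |N_G[X_{p..q}]| and Property B (1),(3) make their
-- union tight, contradicting maximality.  So Q cuts X into its members and the gaps
-- between them, of total length n - 1.  The sets ⋃_{s ∈ Q} N_G[s], ⋃_{gaps g} N'_G[g]
-- and R are pairwise disjoint, of sizes Σ_Q (q - p + 1), ≥ Σ_gaps (q - p) (Property B (2))
-- and |R|; hence n - 1 + |Q| + |R| ≤ |Y| ≤ n + 1 by Property B (1).

open import Data.Nat using (ℕ; zero; suc; _+_; _∸_; _≤_; _<_; z≤n; s≤s; s≤s⁻¹; _≤ᵇ_; _<ᵇ_; _<?_; _≤?_)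
open import Data.Nat.Properties
open import Data.Nat.Tactic.RingSolver using (solve-∀)
open import Algebra.Properties.CommutativeSemigroup +-commutativeSemigroup using (interchange)
open import Data.Fin using (Fin; toℕ; fromℕ) renaming (zero to fzero; suc to fsuc)
open import Data.Fin.Properties using (toℕ-injective; toℕ<n; toℕ-fromℕ)
open import Data.Bool using (Bool; true; false; T; _∧_; _∨_; not; if_then_else_)
open import Data.Bool.Properties using (T-∧; T-∨)
open import Data.Bool.ListAction using (any)
open import Data.List using (List; []; _∷_; length; map; allFin; filterᵇ; _++_)
open import Data.List.Properties using (map-tabulate; length-++; length-map)
open import Data.Nat.ListAction using (sum)
open import Data.List.Relation.Unary.All as All using (All; []; _∷_)
open import Data.List.Relation.Unary.All.Properties using (all⁺; all⁻; all-filter; ++⁺)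
  renaming (map⁺ to All-map⁺)
open import Data.List.Relation.Unary.AllPairs as AllPairs using (AllPairs; []; _∷_)
open import Data.List.Relation.Unary.AllPairs.Properties using (tabulate⁺-<)
  renaming (filter⁺ to AllPairs-filter⁺; map⁺ to AllPairs-map⁺; ++⁺ to AllPairs-++⁺)
open import Data.List.Relation.Unary.Any using (here; there)
open import Data.List.Relation.Unary.Any.Properties using (any⁺; any⁻)
open import Data.List.Membership.Propositional using (_∈_; find; lose)
open import Data.List.Membership.Propositional.Properties using (∈-allFin)
open import Data.Product using (Σ; _×_; _,_; proj₁; proj₂)
open import Data.Sum using (_⊎_; inj₁; inj₂)
open import Data.Empty using (⊥-elim)
open import Data.Unit using (tt)
open import Function.Bundles using (Equivalence)
open import Relation.Nullary using (¬_; yes; no)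
open import Relation.Nullary.Decidable using (T?)
open import Relation.Binary.PropositionalEquality
  using (_≡_; refl; sym; trans; cong; cong₂; subst; module ≡-Reasoning)
open import Relation.Binary.Construct.Closure.ReflexiveTransitive using (_◅_)
open import Defs

∧⁻ : ∀ {a b} → T (a ∧ b) → T a × T b
∧⁻ {a} {b} = Equivalence.to (T-∧ {a} {b})

∧⁺ : ∀ {a b} → T a → T b → T (a ∧ b)
∧⁺ {a} {b} ta tb = Equivalence.from (T-∧ {a} {b}) (ta , tb)

∨⁻ : ∀ {a b} → T (a ∨ b) → T a ⊎ T b
∨⁻ {a} {b} = Equivalence.to (T-∨ {a} {b})

∨⁺ : ∀ {a b} → T a ⊎ T b → T (a ∨ b)
∨⁺ {a} {b} = Equivalence.from (T-∨ {a} {b})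

not⁻ : ∀ {a} → T (not a) → ¬ T a
not⁻ {true} ()

indicator : Bool → ℕ
indicator b = if b then 1 else 0

countB-suc : ∀ {k} (f : Fin (suc k) → Bool) →
  countB f ≡ indicator (f fzero) + countB (λ i → f (fsuc i))
countB-suc {k} f = cong (λ l → indicator (f fzero) + sum l)
  (trans (map-tabulate fsuc (λ i → indicator (f i)))
         (sym (map-tabulate (λ i → i) (λ i → indicator (f (fsuc i))))))

countB-mono : ∀ {k} (f g : Fin k → Bool) → (∀ i → T (f i) → T (g i)) → countB f ≤ countB g
countB-mono {zero} f g f⊆g = z≤n
countB-mono {suc k} f g f⊆g rewrite countB-suc f | countB-suc g =
  +-mono-≤ (head (f fzero) (g fzero) (f⊆g fzero))
           (countB-mono (λ i → f (fsuc i)) (λ i → g (fsuc i)) (λ i → f⊆g (fsuc i)))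
  where
  head : ∀ a b → (T a → T b) → indicator a ≤ indicator b
  head false b _ = z≤n
  head true true _ = ≤-refl
  head true false a⇒b = ⊥-elim (a⇒b tt)

countB-all : ∀ {k} (f : Fin k → Bool) → (∀ i → T (f i)) → countB f ≡ k
countB-all {zero} f all-f = refl
countB-all {suc k} f all-f rewrite countB-suc f with f fzero | all-f fzero
... | true | _ = cong suc (countB-all (λ i → f (fsuc i)) (λ i → all-f (fsuc i)))

countB-≤ : ∀ {k} (f : Fin k → Bool) → countB f ≤ k
countB-≤ {k} f = ≤-trans (countB-mono f (λ _ → true) (λ _ _ → tt))
                         (≤-reflexive (countB-all (λ _ → true) (λ _ → tt)))

countB-none : ∀ {k} (f : Fin k → Bool) → (∀ i → ¬ T (f i)) → countB f ≡ 0
countB-none {zero} f none = refl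
countB-none {suc k} f none rewrite countB-suc f with f fzero | none fzero
... | true | ¬f0 = ⊥-elim (¬f0 tt)
... | false | _ = countB-none (λ i → f (fsuc i)) (λ i → none (fsuc i))

countB-∪∩ : ∀ {k} (f g : Fin k → Bool) →
  countB (λ i → f i ∨ g i) + countB (λ i → f i ∧ g i) ≡ countB f + countB g
countB-∪∩ {zero} f g = refl
countB-∪∩ {suc k} f g
  rewrite countB-suc (λ i → f i ∨ g i) | countB-suc (λ i → f i ∧ g i)
        | countB-suc f | countB-suc g
  = head (f fzero) (g fzero) (countB-∪∩ (λ i → f (fsuc i)) (λ i → g (fsuc i)))
  where
  head : ∀ a b {x y u v} → x + y ≡ u + v →
    (indicator (a ∨ b) + x) + (indicator (a ∧ b) + y) ≡ (indicator a + u) + (indicator b + v)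
  head false false e = e
  head false true {u = u} {v} e = trans (cong suc e) (sym (+-suc u v))
  head true false e = cong suc e
  head true true {x} {y} {u} {v} e =
    cong suc (trans (+-suc x y) (trans (cong suc e) (sym (+-suc u v))))

countB-disjoint : ∀ {k} (f g : Fin k → Bool) → (∀ i → T (f i) → ¬ T (g i)) →
  countB (λ i → f i ∨ g i) ≡ countB f + countB g
countB-disjoint f g disj = trans (sym (+-identityʳ _))
  (trans (cong (countB (λ i → f i ∨ g i) +_)
               (sym (countB-none (λ i → f i ∧ g i) (λ i fg → let (fi , gi) = ∧⁻ {f i} fg in disj i fi gi))))
         (countB-∪∩ f g))

countB-pos : ∀ {k} (f : Fin k → Bool) (i : Fin k) → T (f i) → 1 ≤ countB f
countB-pos {suc k} f fzero fi rewrite countB-suc f with f fzero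
... | true = s≤s z≤n
countB-pos {suc k} f (fsuc i) fi rewrite countB-suc f =
  ≤-trans (countB-pos (λ j → f (fsuc j)) i fi) (m≤n+m _ (indicator (f fzero)))

countB-witness : ∀ {k} (f : Fin k → Bool) → 1 ≤ countB f → Σ (Fin k) λ i → T (f i)
countB-witness {zero} f ()
countB-witness {suc k} f pos rewrite countB-suc f with f fzero in eq
... | true = fzero , subst T (sym eq) tt
... | false with countB-witness (λ i → f (fsuc i)) pos
... | i , fi = fsuc i , fi

countB-witness₂ : ∀ {k} (f : Fin k → Bool) → 2 ≤ countB f →
  Σ (Fin k) λ i → Σ (Fin k) λ j → toℕ i < toℕ j × T (f i) × T (f j)
countB-witness₂ {zero} f ()
countB-witness₂ {suc k} f two rewrite countB-suc f with f fzero in eq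
... | true with countB-witness (λ i → f (fsuc i)) (s≤s⁻¹ two)
... | j , fj = fzero , fsuc j , s≤s z≤n , subst T (sym eq) tt , fj
countB-witness₂ {suc k} f two | false with countB-witness₂ (λ i → f (fsuc i)) two
... | i , j , i<j , fi , fj = fsuc i , fsuc j , s≤s i<j , fi , fj

countB-atMostOne : ∀ {k} (f : Fin k → Bool) → (∀ i j → T (f i) → T (f j) → i ≡ j) → countB f ≤ 1
countB-atMostOne f unique = ≮⇒≥ λ two →
  let (i , j , i<j , fi , fj) = countB-witness₂ f two
  in <-irrefl (cong toℕ (unique i j fi fj)) i<j

∸-+-cancel : ∀ {p q} → p ≤ q → (q ∸ p + 1) + p ≡ q + 1
∸-+-cancel {p} {q} p≤q = begin
  (q ∸ p + 1) + p ≡⟨ +-assoc (q ∸ p) 1 p ⟩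
  q ∸ p + (1 + p) ≡⟨ cong (q ∸ p +_) (+-comm 1 p) ⟩
  q ∸ p + (p + 1) ≡⟨ +-assoc (q ∸ p) p 1 ⟨
  (q ∸ p + p) + 1 ≡⟨ cong (_+ 1) (m∸n+n≡m p≤q) ⟩
  q + 1           ∎
  where open ≡-Reasoning

length-filterᵇ : ∀ {A : Set} (f : A → Bool) (xs : List A) →
  length (filterᵇ f xs) ≡ sum (map (λ x → indicator (f x)) xs)
length-filterᵇ f [] = refl
length-filterᵇ f (x ∷ xs) with f x
... | true = cong suc (length-filterᵇ f xs)
... | false = length-filterᵇ f xs

summand≤sum : ∀ {A : Set} (f : A → ℕ) {xs : List A} {x : A} → x ∈ xs → f x ≤ sum (map f xs)
summand≤sum f (here refl) = m≤m+n _ _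
summand≤sum f {y ∷ xs} (there x∈) = ≤-trans (summand≤sum f x∈) (m≤n+m _ (f y))

endpoints : ∀ {k} (x : Fin k) → 0 < toℕ x →
  Σ (Fin k) λ first → Σ (Fin k) λ last → toℕ first ≡ 0 × suc (toℕ last) ≡ k × 0 < toℕ last
endpoints {suc k} x x>0 = fzero , fromℕ k , refl , cong suc (toℕ-fromℕ k)
  , subst (0 <_) (sym (toℕ-fromℕ k)) (<-≤-trans x>0 (s≤s⁻¹ (toℕ<n x)))

module Basics (G : ConvexBipartite) where
  open ConvexBipartite G

  Between : Fin n → Fin n → Fin n → Set
  Between p q x = toℕ p ≤ toℕ x × toℕ x ≤ toℕ q

  inRange⁺ : ∀ {p q x} → Between p q x → T (inRange G p q x)
  inRange⁺ (p≤x , x≤q) = ∧⁺ (≤⇒≤ᵇ p≤x) (≤⇒≤ᵇ x≤q)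

  inRange⁻ : ∀ {p q x} → T (inRange G p q x) → Between p q x
  inRange⁻ {p} {q} {x} t = let (p≤x , x≤q) = ∧⁻ {toℕ p ≤ᵇ toℕ x} t
                           in ≤ᵇ⇒≤ _ _ p≤x , ≤ᵇ⇒≤ _ _ x≤q

  inN⁺ : ∀ {p q y} → (∀ x → T (adj x y) → Between p q x) → T (inN G p q y)
  inN⁺ {p} {q} {y} nbrs = all⁻ _ {allFin n} (All.tabulate λ {x} _ → member x)
    where
    member : ∀ x → T (not (adj x y) ∨ inRange G p q x)
    member x with adj x y in eq
    ... | false = tt
    ... | true = inRange⁺ (nbrs x (subst T (sym eq) tt))

  inN⁻ : ∀ p q {y x} → T (inN G p q y) → T (adj x y) → Between p q x
  inN⁻ p q {y} {x} t xy with ∨⁻ {not (adj x y)} (All.lookup (all⁺ _ (allFin n) t) (∈-allFin x))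
  ... | inj₁ ¬xy = ⊥-elim (not⁻ ¬xy xy)
  ... | inj₂ x∈ = inRange⁻ x∈

  inN′⁻ : ∀ {p q y} → T (inN′ G p q y) →
    Σ (Fin n) λ i → Σ (Fin n) λ j → toℕ i < toℕ j ×
      T (adj i y) × T (adj j y) × Between p q i × Between p q j
  inN′⁻ {p} {q} {y} t with countB-witness₂ (λ x → adj x y ∧ inRange G p q x) (≤ᵇ⇒≤ 2 _ t)
  ... | i , j , i<j , ti , tj =
    let (iy , i∈) = ∧⁻ {adj i y} ti ; (jy , j∈) = ∧⁻ {adj j y} tj
    in i , j , i<j , iy , jy , inRange⁻ i∈ , inRange⁻ j∈

  inN′⇒degree≥2 : ∀ {p q y} → T (inN′ G p q y) → 2 ≤ degY G y
  inN′⇒degree≥2 {p} {q} {y} t =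
    ≤-trans (≤ᵇ⇒≤ 2 _ t) (countB-mono _ _ λ x t → proj₁ (∧⁻ {adj x y} t))

  tight⁻ : ∀ {p q} → toℕ p ≤ toℕ q → T (tight G p q) → sizeN G p q + toℕ p ≡ toℕ q + 1
  tight⁻ {p} {q} p≤q t = trans (cong (_+ toℕ p) (≡ᵇ⇒≡ (sizeN G p q) _ t)) (∸-+-cancel p≤q)

  tight⁺ : ∀ {p q} → toℕ p ≤ toℕ q → sizeN G p q + toℕ p ≡ toℕ q + 1 → T (tight G p q)
  tight⁺ {p} p≤q e = ≡⇒≡ᵇ _ _ (+-cancelʳ-≡ (toℕ p) _ _ (trans e (sym (∸-+-cancel p≤q))))

  record Interior (p q : Fin n) : Set where
    field
      start  : 0 < toℕ p
      proper : toℕ p < toℕ q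
      end    : suc (toℕ q) < n

  maximal⇒tight : ∀ {p q} → T (maximal G p q) → T (tight G p q)
  maximal⇒tight {p} {q} t = proj₁ (∧⁻ {tight G p q} (proj₂ (∧⁻ {toℕ p <ᵇ toℕ q} t)))

  inQ⁻ : ∀ {p q} → T (inQ G p q) → T (maximal G p q) × Interior p q
  inQ⁻ {p} {q} t =
    let (mx , t₁) = ∧⁻ {maximal G p q} t ; (s , t₂) = ∧⁻ {0 <ᵇ toℕ p} t₁
        (pr , e) = ∧⁻ {toℕ p <ᵇ toℕ q} t₂
    in mx , record { start = <ᵇ⇒< _ _ s ; proper = <ᵇ⇒< _ _ pr ; end = <ᵇ⇒< _ _ e }

  inQ⁺ : ∀ {p q} → T (maximal G p q) → Interior p q → T (inQ G p q)
  inQ⁺ mx I = ∧⁺ mx (∧⁺ (<⇒<ᵇ start) (∧⁺ (<⇒<ᵇ proper) (<⇒<ᵇ end)))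
    where open Interior I

  Extends : Fin n → Fin n → Fin n → Fin n → Set
  Extends p q p′ q′ = (toℕ p′ < toℕ p × toℕ q ≤ toℕ q′) ⊎ (toℕ p′ ≤ toℕ p × toℕ q < toℕ q′)

  maximal⁻ : ∀ {p q p′ q′} → T (maximal G p q) → Interior p′ q′ → T (tight G p′ q′) →
    ¬ Extends p q p′ q′
  maximal⁻ {p} {q} {p′} {q′} mx I t′ ext =
    not⁻ (proj₂ (∧⁻ {tight G p q} (proj₂ (∧⁻ {toℕ p <ᵇ toℕ q} mx))))
      (any⁺ _ (lose (∈-allFin p′) (any⁺ _ (lose (∈-allFin q′)
        (∧⁺ (<⇒<ᵇ proper) (∧⁺ t′ (∨⁺ (witness ext))))))))
    where
    open Interior I
    witness : Extends p q p′ q′ →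
      T ((0 <ᵇ toℕ p′) ∧ (toℕ p′ <ᵇ toℕ p) ∧ (toℕ q ≤ᵇ toℕ q′) ∧ (suc (toℕ q′) <ᵇ n))
      ⊎ T ((0 <ᵇ toℕ p′) ∧ (toℕ p′ ≤ᵇ toℕ p) ∧ (toℕ q <ᵇ toℕ q′) ∧ (suc (toℕ q′) <ᵇ n))
    witness (inj₁ (a , b)) = inj₁ (∧⁺ (<⇒<ᵇ start) (∧⁺ (<⇒<ᵇ a) (∧⁺ (≤⇒≤ᵇ b) (<⇒<ᵇ end))))
    witness (inj₂ (a , b)) = inj₂ (∧⁺ (<⇒<ᵇ start) (∧⁺ (≤⇒≤ᵇ a) (∧⁺ (<⇒<ᵇ b) (<⇒<ᵇ end))))

  -- Supermodularity of interval neighbourhoods: for pa ≤ pb and qa ≤ qb,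
  -- N[X_{pa..qa}] ∪ N[X_{pb..qb}] ⊆ N[X_{pa..qb}] and their intersection ⊆ N[X_{pb..qa}].
  sizeN-supermodular : ∀ {pa qa pb qb} → toℕ pa ≤ toℕ pb → toℕ qa ≤ toℕ qb →
    sizeN G pa qa + sizeN G pb qb ≤ sizeN G pa qb + sizeN G pb qa
  sizeN-supermodular {pa} {qa} {pb} {qb} pa≤pb qa≤qb = begin
    countB A + countB B                              ≡⟨ countB-∪∩ A B ⟨
    countB (λ y → A y ∨ B y) + countB (λ y → A y ∧ B y)
      ≤⟨ +-mono-≤ (countB-mono _ _ union) (countB-mono _ _ intersection) ⟩
    sizeN G pa qb + sizeN G pb qa                    ∎
    where
    open ≤-Reasoning
    A B : Fin m → Bool
    A = inN G pa qa
    B = inN G pb qb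
    union : ∀ y → T (A y ∨ B y) → T (inN G pa qb y)
    union y t with ∨⁻ {A y} t
    ... | inj₁ a = inN⁺ λ x xy → let (l , u) = inN⁻ pa qa a xy in l , ≤-trans u qa≤qb
    ... | inj₂ b = inN⁺ λ x xy → let (l , u) = inN⁻ pb qb b xy in ≤-trans pa≤pb l , u
    intersection : ∀ y → T (A y ∧ B y) → T (inN G pb qa y)
    intersection y t = let (a , b) = ∧⁻ {A y} t in
      inN⁺ λ x xy → proj₁ (inN⁻ pb qb b xy) , proj₂ (inN⁻ pa qa a xy)

  Pair : Set
  Pair = Fin n × Fin n

  lo hi : Pair → ℕ
  lo s = toℕ (proj₁ s)
  hi s = toℕ (proj₂ s)

  InQ : Pair → Set
  InQ s = T (inQ G (proj₁ s) (proj₂ s))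

  Lex : Pair → Pair → Set
  Lex a b = lo a < lo b ⊎ (proj₁ a ≡ proj₁ b × hi a < hi b)

  Q-tight : ∀ s → InQ s → T (tight G (proj₁ s) (proj₂ s))
  Q-tight (p , q) s∈Q = maximal⇒tight {p} {q} (proj₁ (inQ⁻ {p} {q} s∈Q))

  Q-interior : ∀ s → InQ s → Interior (proj₁ s) (proj₂ s)
  Q-interior (p , q) s∈Q = proj₂ (inQ⁻ {p} {q} s∈Q)

module Spine (G : ConvexBipartite) (last : Fin (ConvexBipartite.n G)) where
  open ConvexBipartite G
  open Basics G

  data Spaced (a : Fin n) : List Pair → Set where
    done : toℕ a < toℕ last → Spaced a []
    next : ∀ {p q S} → toℕ a < toℕ p → toℕ p < toℕ q → Spaced q S → Spaced a ((p , q) ∷ S)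

  gaps : Fin n → List Pair → List Pair
  gaps a [] = (a , last) ∷ []
  gaps a ((p , q) ∷ S) = (a , p) ∷ gaps q S

  Spaced-left : ∀ {a S} → Spaced a S → All (λ s → toℕ a < lo s) S
  Spaced-left (done _) = []
  Spaced-left (next a<p p<q sp) = a<p ∷ All.map (λ q<s → <-trans a<p (<-trans p<q q<s)) (Spaced-left sp)

  gaps-left : ∀ {a S} → Spaced a S → All (λ g → toℕ a ≤ lo g) (gaps a S)
  gaps-left (done _) = ≤-refl ∷ []
  gaps-left (next a<p p<q sp) = ≤-refl ∷ All.map (λ q≤g → ≤-trans (<⇒≤ (<-trans a<p p<q)) q≤g) (gaps-left sp)

  gaps-length : ∀ a S → length (gaps a S) ≡ suc (length S)
  gaps-length a [] = refl
  gaps-length a ((p , q) ∷ S) = cong suc (gaps-length q S)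

  gaps-chain : ∀ {a S} → Spaced a S → Chain G (gaps a S)
  gaps-chain (done a<last) = chain-[ a<last ]
  gaps-chain (next a<p p<q (done q<last)) = chain-∷ a<p (<⇒≤ p<q) chain-[ q<last ]
  gaps-chain (next a<p p<q sp@(next _ _ _)) = chain-∷ a<p (<⇒≤ p<q) (gaps-chain sp)

  gaps-nonempty : ∀ {a S} → Spaced a S → length (gaps a S) ≤ sumLen G (gaps a S)
  gaps-nonempty (done a<last) = +-monoˡ-≤ 0 (m<n⇒0<n∸m a<last)
  gaps-nonempty (next a<p _ sp) = +-mono-≤ (m<n⇒0<n∸m a<p) (gaps-nonempty sp)

  spine-length : ∀ {a S} → Spaced a S → sumLen G (gaps a S) + sumLen G S + toℕ a ≡ toℕ last
  spine-length {a} (done a<last) = begin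
    (toℕ last ∸ toℕ a + 0) + 0 + toℕ a ≡⟨ cong (_+ toℕ a) (trans (+-identityʳ _) (+-identityʳ _)) ⟩
    toℕ last ∸ toℕ a + toℕ a           ≡⟨ m∸n+n≡m (<⇒≤ a<last) ⟩
    toℕ last                           ∎
    where open ≡-Reasoning
  spine-length {a} {(p , q) ∷ S} (next a<p p<q sp) = begin
    ((p∸a + Gs) + (q∸p + Ss)) + toℕ a ≡⟨ rearrange p∸a Gs q∸p Ss (toℕ a) ⟩
    (Gs + Ss) + (q∸p + (p∸a + toℕ a)) ≡⟨ cong (λ x → (Gs + Ss) + (q∸p + x)) (m∸n+n≡m (<⇒≤ a<p)) ⟩
    (Gs + Ss) + (q∸p + toℕ p)         ≡⟨ cong (Gs + Ss +_) (m∸n+n≡m (<⇒≤ p<q)) ⟩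
    (Gs + Ss) + toℕ q                 ≡⟨ spine-length sp ⟩
    toℕ last                          ∎
    where
    open ≡-Reasoning
    p∸a = toℕ p ∸ toℕ a
    q∸p = toℕ q ∸ toℕ p
    Gs = sumLen G (gaps q S)
    Ss = sumLen G S
    rearrange : ∀ u x v y b → ((u + x) + (v + y)) + b ≡ (x + y) + (v + (u + b))
    rearrange = solve-∀

  gap-overlap : ∀ {a S s g} → Spaced a S → s ∈ S → g ∈ gaps a S → hi g ≤ lo s ⊎ hi s ≤ lo g
  gap-overlap (next _ _ _) (here refl) (here refl) = inj₁ ≤-refl
  gap-overlap (next _ _ sp) (here refl) (there g∈) = inj₂ (All.lookup (gaps-left sp) g∈)
  gap-overlap (next _ p<q sp) (there s∈) (here refl) = inj₁ (<⇒≤ (<-trans p<q (All.lookup (Spaced-left sp) s∈)))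
  gap-overlap (next _ _ sp) (there s∈) (there g∈) = gap-overlap sp s∈ g∈

module Enumeration (G : ConvexBipartite) where
  open ConvexBipartite G
  open Basics G

  Q-from : List (Fin n) → List Pair
  Q-from [] = []
  Q-from (p ∷ ps) = map (p ,_) (filterᵇ (inQ G p) (allFin n)) ++ Q-from ps

  Q-list : List Pair
  Q-list = Q-from (allFin n)

  Q-list-length : length Q-list ≡ sizeQ G
  Q-list-length = go (allFin n)
    where
    go : ∀ ps → length (Q-from ps) ≡ sum (map (λ p → countB (inQ G p)) ps)
    go [] = refl
    go (p ∷ ps) = trans (length-++ (map (p ,_) (filterᵇ (inQ G p) (allFin n))))
      (cong₂ _+_ (trans (length-map (p ,_) (filterᵇ (inQ G p) (allFin n)))
                        (length-filterᵇ (inQ G p) (allFin n)))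
                 (go ps))

  Q-list-inQ : All InQ Q-list
  Q-list-inQ = go (allFin n)
    where
    go : ∀ ps → All InQ (Q-from ps)
    go [] = []
    go (p ∷ ps) = ++⁺ (All-map⁺ (all-filter (λ q → T? (inQ G p q)) (allFin n))) (go ps)

  Q-from-left : ∀ {P : Fin n → Set} {ps} → All P ps → All (λ s → P (proj₁ s)) (Q-from ps)
  Q-from-left [] = []
  Q-from-left (Pp ∷ Pps) = ++⁺ (All-map⁺ (All.universal (λ _ → Pp) _)) (Q-from-left Pps)

  allFin-increasing : AllPairs (λ i j → toℕ i < toℕ j) (allFin n)
  allFin-increasing = tabulate⁺-< (λ i<j → i<j)

  Q-from-sorted : ∀ {ps} → AllPairs (λ i j → toℕ i < toℕ j) ps → AllPairs Lex (Q-from ps)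
  Q-from-sorted [] = []
  Q-from-sorted {p ∷ ps} (p<ps ∷ sorted) = AllPairs-++⁺
    (AllPairs-map⁺ (AllPairs-filter⁺ (λ q → T? (inQ G p q))
      (AllPairs.map (λ q<q′ → inj₂ (refl , q<q′)) allFin-increasing)))
    (Q-from-sorted sorted)
    (All-map⁺ (All.universal (λ _ → All.map inj₁ (Q-from-left p<ps)) _))

  Q-list-sorted : AllPairs Lex Q-list
  Q-list-sorted = Q-from-sorted allFin-increasing

module Consequences (G : ConvexBipartite) (conn : Connected G) (PB : PropertyB G) where
  open ConvexBipartite G
  open PropertyB PB
  open Basics G

  -- In a connected graph every y ∈ Y has a neighbour (the first step of a path to any x).
  neighbour : Fin n → (y : Fin m) → Σ (Fin n) λ x → T (adj x y)
  neighbour x₀ y with conn (inj₂ y) (inj₁ x₀)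
  ... | _◅_ {j = inj₁ x} xy _ = x , xy

  inN-single⇒pendant : ∀ {p y} → T (inN G p p y) → T (adj p y ∧ pendantY G y)
  inN-single⇒pendant {p} {y} t with neighbour p y
  ... | x , xy = ∧⁺ (subst (λ x → T (adj x y)) (only-p xy) xy)
    (≡⇒≡ᵇ _ _ (≤-antisym (countB-atMostOne (λ x → adj x y) unique) (countB-pos (λ x → adj x y) x xy)))
    where
    only-p : ∀ {x′} → T (adj x′ y) → x′ ≡ p
    only-p x′y = let (l , u) = inN⁻ p p t x′y in toℕ-injective (≤-antisym u l)
    unique : ∀ i j → T (adj i y) → T (adj j y) → i ≡ j
    unique i j iy jy = trans (only-p iy) (sym (only-p jy))

  -- Property B (1) and (3) bound every interval avoiding x_1 by its length:
  -- |N_G[X_{p..q}]| ≤ q - p + 1 whenever 1 < p ≤ q.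
  interior-bound : ∀ {p q} → 2 ≤ n → 0 < toℕ p → toℕ p ≤ toℕ q → sizeN G p q + toℕ p ≤ toℕ q + 1
  interior-bound {p} {q} n≥2 p>0 p≤q with m≤n⇒m<n∨m≡n p≤q
  ... | inj₁ p<q = ≤-trans (+-monoˡ-≤ (toℕ p) (B1 p q p<q λ (p≡0 , _) → <⇒≢ p>0 (sym p≡0)))
                           (≤-reflexive (∸-+-cancel p≤q))
  ... | inj₂ p≡q rewrite toℕ-injective p≡q =
    ≤-trans (+-monoˡ-≤ (toℕ q)
              (≤-trans (countB-mono (inN G q q) _ λ y t → inN-single⇒pendant {q} {y} t) (B3-adj n≥2 q)))
            (≤-reflexive (+-comm 1 (toℕ q)))

  tight-union : ∀ {pa qa pb qb} → 2 ≤ n → 0 < toℕ pa →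
    toℕ pa ≤ toℕ pb → toℕ pb ≤ toℕ qa → toℕ qa ≤ toℕ qb →
    T (tight G pa qa) → T (tight G pb qb) → T (tight G pa qb)
  tight-union {pa} {qa} {pb} {qb} n≥2 pa>0 pa≤pb pb≤qa qa≤qb ta tb =
    tight⁺ pa≤qb (≤-antisym upper lower)
    where
    pa≤qb : toℕ pa ≤ toℕ qb
    pa≤qb = ≤-trans pa≤pb (≤-trans pb≤qa qa≤qb)
    A B C D : ℕ
    A = sizeN G pa qa
    B = sizeN G pb qb
    C = sizeN G pa qb
    D = sizeN G pb qa
    upper : C + toℕ pa ≤ toℕ qb + 1
    upper = interior-bound n≥2 pa>0 pa≤qb
    open ≤-Reasoning
    lower′ : (toℕ qb + 1) + (toℕ qa + 1) ≤ (C + toℕ pa) + (toℕ qa + 1)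
    lower′ = begin
      (toℕ qb + 1) + (toℕ qa + 1)       ≡⟨ +-comm (toℕ qb + 1) (toℕ qa + 1) ⟩
      (toℕ qa + 1) + (toℕ qb + 1)
        ≡⟨ cong₂ _+_ (tight⁻ (≤-trans pa≤pb pb≤qa) ta) (tight⁻ (≤-trans pb≤qa qa≤qb) tb) ⟨
      (A + toℕ pa) + (B + toℕ pb)       ≡⟨ interchange A (toℕ pa) B (toℕ pb) ⟩
      (A + B) + (toℕ pa + toℕ pb)       ≤⟨ +-monoˡ-≤ (toℕ pa + toℕ pb) (sizeN-supermodular pa≤pb qa≤qb) ⟩
      (C + D) + (toℕ pa + toℕ pb)       ≡⟨ interchange C D (toℕ pa) (toℕ pb) ⟩
      (C + toℕ pa) + (D + toℕ pb)
        ≤⟨ +-monoʳ-≤ (C + toℕ pa) (interior-bound n≥2 (<-≤-trans pa>0 pa≤pb) pb≤qa) ⟩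
      (C + toℕ pa) + (toℕ qa + 1)       ∎
    lower : toℕ qb + 1 ≤ C + toℕ pa
    lower = +-cancelʳ-≤ (toℕ qa + 1) _ _ lower′

  -- Otherwise one of them, or their tight
  -- union, would extend the other, contradicting maximality.
  Q-separated : ∀ {a b} → InQ a → InQ b → Lex a b → hi a < lo b
  Q-separated {pa , qa} {pb , qb} qa∈Q qb∈Q order with inQ⁻ {pa} {qa} qa∈Q | inQ⁻ {pb} {qb} qb∈Q
  ... | mxa , Ia | mxb , Ib with order
  ...   | inj₂ (refl , qa<qb) =
    ⊥-elim (maximal⁻ {pa} {qa} mxa Ib (maximal⇒tight {pb} {qb} mxb) (inj₂ (≤-refl , qa<qb)))
  ...   | inj₁ pa<pb with toℕ qa <? toℕ pb
  ...     | yes qa<pb = qa<pb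
  ...     | no qa≮pb with toℕ qb ≤? toℕ qa
  ...       | yes qb≤qa =
    ⊥-elim (maximal⁻ {pb} {qb} mxb Ia (maximal⇒tight {pa} {qa} mxa) (inj₁ (pa<pb , qb≤qa)))
  ...       | no qb≰qa = ⊥-elim (maximal⁻ {pa} {qa} mxa Iab union (inj₂ (≤-refl , qa<qb)))
    where
    open Interior
    qa<qb : toℕ qa < toℕ qb
    qa<qb = ≰⇒> qb≰qa
    n≥2 : 2 ≤ n
    n≥2 = ≤-trans (s≤s (s≤s z≤n)) (end Ib)
    union : T (tight G pa qb)
    union = tight-union n≥2 (start Ia) (<⇒≤ pa<pb) (≮⇒≥ qa≮pb) (<⇒≤ qa<qb)
              (maximal⇒tight {pa} {qa} mxa) (maximal⇒tight {pb} {qb} mxb)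
    Iab : Interior pa qb
    Iab = record { start = start Ia ; proper = <-trans (proper Ia) qa<qb ; end = end Ib }

module Counting (G : ConvexBipartite) (conn : Connected G) (PB : PropertyB G)
                (last : Fin (ConvexBipartite.n G)) where
  open ConvexBipartite G
  open PropertyB PB
  open Basics G
  open Consequences G conn PB
  open Spine G last

  covered crossing : List Pair → Fin m → Bool
  covered S y = any (λ s → inN G (proj₁ s) (proj₂ s) y) S
  crossing S y = any (λ g → inN′ G (proj₁ g) (proj₂ g) y) S

  -- Spaced tight intervals have disjoint neighbourhoods, so |⋃ N_G[s]| = Σ (q - p + 1).
  count-covered : ∀ {a S} → Spaced a S → All (λ s → T (tight G (proj₁ s) (proj₂ s))) S →
    countB (covered S) ≡ sumLen G S + length S
  count-covered (done _) [] = countB-none (covered []) (λ _ ())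
  count-covered {S = (p , q) ∷ S} (next _ _ sp) (t ∷ ts) = begin
    countB (λ y → inN G p q y ∨ covered S y)       ≡⟨ countB-disjoint (inN G p q) (covered S) disjoint ⟩
    sizeN G p q + countB (covered S)               ≡⟨ cong₂ _+_ (≡ᵇ⇒≡ (sizeN G p q) _ t) (count-covered sp ts) ⟩
    (toℕ q ∸ toℕ p + 1) + (sumLen G S + length S) ≡⟨ rearrange (toℕ q ∸ toℕ p) (sumLen G S) (length S) ⟩
    (toℕ q ∸ toℕ p + sumLen G S) + suc (length S)  ∎
    where
    open ≡-Reasoning
    rearrange : ∀ u v w → (u + 1) + (v + w) ≡ (u + v) + suc w
    rearrange u v w = trans (cong (_+ (v + w)) (+-comm u 1))
      (trans (cong suc (sym (+-assoc u v w))) (sym (+-suc (u + v) w)))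
    disjoint : ∀ y → T (inN G p q y) → ¬ T (covered S y)
    disjoint y y∈pq y∈S with find (any⁻ _ S y∈S)
    ... | (p′ , q′) , s∈S , y∈s =
      let (x , xy) = neighbour last y in
      <-irrefl refl (≤-<-trans (≤-trans (proj₁ (inN⁻ p′ q′ y∈s xy)) (proj₂ (inN⁻ p q y∈pq xy)))
                               (All.lookup (Spaced-left sp) s∈S))

  covered-crossing-disjoint : ∀ {a S} → Spaced a S → ∀ y → T (covered S y) → ¬ T (crossing (gaps a S) y)
  covered-crossing-disjoint {a} {S} sp y y∈S y∈gaps
    with find (any⁻ _ S y∈S) | find (any⁻ _ (gaps a S) y∈gaps)
  ... | (p , q) , s∈S , y∈s | g , g∈gaps , y∈g with inN′⁻ y∈g
  ...   | i , j , i<j , iy , jy , (gi , ig) , (gj , jg) with gap-overlap sp s∈S g∈gaps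
  ...     | inj₁ g≤s = <-irrefl refl (<-≤-trans i<j (≤-trans jg (≤-trans g≤s (proj₁ (inN⁻ p q y∈s iy)))))
  ...     | inj₂ s≤g = <-irrefl refl (<-≤-trans i<j (≤-trans (proj₂ (inN⁻ p q y∈s jy)) (≤-trans s≤g gi)))

  -- A vertex of R lies neither in N_G[s] for s ∈ Q (it would then be adjacent to s)
  -- nor in any N'_G[g] (it is pendant).
  R-disjoint : ∀ {S G′} → All InQ S → ∀ y → T (covered S y ∨ crossing G′ y) → ¬ T (inR G y)
  R-disjoint {S} {G′} S⊆Q y y∈ y∈R with ∧⁻ {pendantY G y} y∈R | ∨⁻ {covered S y} y∈
  ... | pendant , unseen | inj₁ y∈S with find (any⁻ _ S y∈S)
  ...   | (p , q) , s∈S , y∈s =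
    let (x , xy) = neighbour last y in
    not⁻ unseen (any⁺ _ (lose (∈-allFin p) (any⁺ _ (lose (∈-allFin q)
      (∧⁺ (All.lookup S⊆Q s∈S) (any⁺ _ (lose (∈-allFin x) (∧⁺ (inRange⁺ (inN⁻ p q y∈s xy)) xy))))))))
  R-disjoint {S} {G′} S⊆Q y y∈ y∈R | pendant , unseen | inj₂ y∈G′ with find (any⁻ _ G′ y∈G′)
  ...   | (p , q) , _ , y∈g = <-irrefl (sym (≡ᵇ⇒≡ (degY G y) 1 pendant)) (inN′⇒degree≥2 {p} {q} {y} y∈g)

  Q-spaced : ∀ {a S} → suc (toℕ last) ≡ n → toℕ a < toℕ last →
    All (λ s → toℕ a < lo s) S → All InQ S → AllPairs Lex S → Spaced a S
  Q-spaced _ a<last [] [] [] = done a<last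
  Q-spaced {S = (p , q) ∷ S} last≡ a<last (a<p ∷ _) (s∈Q ∷ S⊆Q) (s<S ∷ sorted) =
    next a<p (Interior.proper I) (Q-spaced last≡ q<last
      (All.zipWith (λ (s′∈Q , s<s′) → Q-separated s∈Q s′∈Q s<s′) (S⊆Q , s<S)) S⊆Q sorted)
    where
    I : Interior p q
    I = Q-interior (p , q) s∈Q
    q<last : toℕ q < toℕ last
    q<last = s≤s⁻¹ (subst (suc (toℕ q) <_) (sym last≡) (Interior.end I))

  -- Property B (1) for the whole of X: every y ∈ Y lies in N_G[X_{1..n}], so |Y| ≤ n + 1.
  Y-bound : (x₀ : Fin n) → toℕ x₀ ≡ 0 → suc (toℕ last) ≡ n → 0 < toℕ last → m ≤ n + 1
  Y-bound x₀ x₀≡0 last≡ last>0 = begin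
    m                ≡⟨ countB-all (inN G x₀ last) (λ y → inN⁺ λ x _ → everywhere x) ⟨
    sizeN G x₀ last  ≤⟨ B1-full x₀ last (subst (_< toℕ last) (sym x₀≡0) last>0) x₀≡0 last≡ ⟩
    n + 1            ∎
    where
    open ≤-Reasoning
    everywhere : ∀ x → Between x₀ last x
    everywhere x = subst (_≤ toℕ x) (sym x₀≡0) z≤n
                 , s≤s⁻¹ (subst (toℕ x <_) (sym last≡) (toℕ<n x))

  -- Y contains the pairwise disjoint sets ⋃_{s ∈ Q} N_G[s]
  -- (of size Σ (q - p + 1)), ⋃_g N'_G[g] over the gaps g between members of Q (of size
  -- at least Σ (q - p) by Property B (2)) and R.  Members of Q and gaps tile X, so
  -- (n - 1) + |Q| + |R| ≤ |Y| ≤ n + 1.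
  upper-bound : (x₀ : Fin n) → toℕ x₀ ≡ 0 → suc (toℕ last) ≡ n → 0 < toℕ last →
    sizeR G + sizeQ G ≤ 2
  upper-bound x₀ x₀≡0 last≡ last>0 =
    +-cancelˡ-≤ (toℕ last) _ _ (begin
      toℕ last + (sizeR G + sizeQ G)
        ≡⟨ cong (_+ (sizeR G + sizeQ G)) tiling ⟨
      (sumLen G Gs + sumLen G S) + (sizeR G + sizeQ G)
        ≡⟨ rearrange (sumLen G Gs) (sumLen G S) (sizeR G) (sizeQ G) ⟩
      ((sumLen G S + sizeQ G) + sumLen G Gs) + sizeR G
        ≤⟨ +-monoˡ-≤ (sizeR G) (+-mono-≤ (≤-reflexive (sym covered-count)) crossing-bound) ⟩
      (countB (covered S) + countB (crossing Gs)) + sizeR G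
        ≡⟨ partition ⟨
      countB (λ y → (covered S y ∨ crossing Gs y) ∨ inR G y)
        ≤⟨ countB-≤ _ ⟩
      m ≤⟨ Y-bound x₀ x₀≡0 last≡ last>0 ⟩
      n + 1
        ≡⟨ trans (cong (_+ 1) (sym last≡)) (sym (+-suc (toℕ last) 1)) ⟩
      toℕ last + 2 ∎)
    where
    open ≤-Reasoning
    open Enumeration G
    S Gs : List Pair
    S = Q-list
    Gs = gaps x₀ S
    x₀<last : toℕ x₀ < toℕ last
    x₀<last = subst (_< toℕ last) (sym x₀≡0) last>0
    sp : Spaced x₀ S
    sp = Q-spaced last≡ x₀<last
           (All.map (λ {s} s∈Q → subst (_< lo s) (sym x₀≡0) (Interior.start (Q-interior s s∈Q))) Q-list-inQ)
           Q-list-inQ Q-list-sorted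
    tiling : sumLen G Gs + sumLen G S ≡ toℕ last
    tiling = trans (sym (+-identityʳ _))
               (trans (cong (sumLen G Gs + sumLen G S +_) (sym x₀≡0)) (spine-length sp))
    crossing-bound : sumLen G Gs ≤ countB (crossing Gs)
    crossing-bound = B2 Gs (subst (1 ≤_) (sym (gaps-length x₀ S)) (s≤s z≤n))
      (≤-trans (gaps-nonempty sp) (≤-trans (m≤m+n _ _)
        (≤-reflexive (trans tiling (cong (_∸ 1) last≡)))))
      (gaps-chain sp)
    covered-count : countB (covered S) ≡ sumLen G S + sizeQ G
    covered-count = trans (count-covered sp (All.map (λ {s} → Q-tight s) Q-list-inQ))
                          (cong (sumLen G S +_) Q-list-length)
    partition : countB (λ y → (covered S y ∨ crossing Gs y) ∨ inR G y)
              ≡ (countB (covered S) + countB (crossing Gs)) + sizeR G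
    partition = trans (countB-disjoint _ (inR G) (R-disjoint {S} {Gs} Q-list-inQ))
      (cong (_+ sizeR G) (countB-disjoint (covered S) (crossing Gs) (covered-crossing-disjoint sp)))
    rearrange : ∀ g s r q → (g + s) + (r + q) ≡ ((s + q) + g) + r
    rearrange = solve-∀

module LowerBound (G : ConvexBipartite) where
  open ConvexBipartite G
  open Basics G

  inQ⇒sizeQ≥1 : ∀ p q → T (inQ G p q) → 1 ≤ sizeQ G
  inQ⇒sizeQ≥1 p q pq∈Q = ≤-trans (countB-pos (inQ G p) q pq∈Q)
    (summand≤sum (λ p → countB (inQ G p)) (∈-allFin p))

  -- The condition excluded in the definition of R: y is adjacent to a member of Q starting at p.
  seen-by : Fin m → Fin n → Bool
  seen-by y p = any (λ q → inQ G p q ∧ any (λ x → inRange G p q x ∧ adj x y) (allFin n)) (allFin n)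

  -- A witness of non-monotonicity yields a member of Q or a pendant vertex that is
  -- either adjacent to a member of Q or belongs to R.
  lower-bound : NonMonotone G → 1 ≤ sizeR G + sizeQ G
  lower-bound (inj₂ (p , q , mx , p>0 , p<q , q<n)) =
    ≤-trans (inQ⇒sizeQ≥1 p q (inQ⁺ {p} {q} mx (record { start = p>0 ; proper = p<q ; end = q<n })))
            (m≤n+m _ _)
  lower-bound (inj₁ (y , _ , pendant , _ , _ , _)) with any (seen-by y) (allFin n) in seen
  ... | true with find (any⁻ (seen-by y) (allFin n) (subst T (sym seen) tt))
  ...   | p , _ , p-sees with find (any⁻ _ (allFin n) p-sees)
  ...     | q , _ , q-sees = ≤-trans (inQ⇒sizeQ≥1 p q (proj₁ (∧⁻ {inQ G p q} q-sees))) (m≤n+m _ _)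
  lower-bound (inj₁ (y , _ , pendant , _ , _ , _)) | false =
    ≤-trans (countB-pos (inR G) y (∧⁺ pendant (subst (λ b → T (not b)) (sym seen) tt))) (m≤m+n _ _)

  interior-vertex : NonMonotone G → Σ (Fin n) λ x → 0 < toℕ x
  interior-vertex (inj₁ (_ , x , _ , _ , x>0 , _)) = x , x>0
  interior-vertex (inj₂ (p , _ , _ , p>0 , _)) = p , p>0

lemma11 : (G : ConvexBipartite) → Connected G → PropertyB G → NonMonotone G →
          (1 ≤ sizeR G + sizeQ G) × (sizeR G + sizeQ G ≤ 2)
lemma11 G conn PB nm with LowerBound.interior-vertex G nm
... | x , x>0 with endpoints x x>0
...   | first , last , first≡0 , last≡ , last>0 =
  LowerBound.lower-bound G nm , Counting.upper-bound G conn PB last first first≡0 last≡ last>0
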